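{- Let $\mathbf{P}$ be the set of prime numbers and let $\mathbf{X_1}=(\mathbf{N}_1,\tau_1)$ be the space defined in the context. Then $\mathbf{P}$ is dense in $\mathbf{X_1}$.
   Context: $\mathbf{N}$ denotes the set of positive integers. For $n\in\mathbf{N}$ let $\sigma_n=\{m\in\mathbf{N}:\gcd(n,m)=1\}$. The family $\{\sigma_n:n\in\mathbf{N}\}$ is a base for a topology $\tau$ on $\mathbf{N}$. Let $\mathbf{N}_1=\mathbf{N}\setminus\{1\}$ and let $\tau_1=\{\mathbf{N}_1\cap\mathcal{O}:\mathcal{O}\in\tau\}$ be the subspace topology on $\mathbf{N}_1$; $\mathbf{X_1}=(\mathbf{N}_1,\tau_1)$. -}

module Defs where

open import Level using (0ℓ)
open import Data.Nat using (ℕ; _≤_)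
open import Data.Nat.GCD using (gcd)
open import Data.Nat.Primality using (Prime)
open import Data.Product using (Σ; ∃; _×_)
open import Relation.Binary.PropositionalEquality using (_≡_)
open import Relation.Unary using (Pred; _⊆_)
open import Function.Bundles using (_⇔_)

-- Subsets of ℕ are predicates.  The positive integers 𝐍 are {x | 1 ≤ x}.
Subset : Set₁
Subset = Pred ℕ 0ℓ

σ : ℕ → Subset
σ n m = (1 ≤ m) × (gcd n m ≡ 1)

-- Open sets of τ: subsets of 𝐍 that are unions of basic sets σ_n (n ∈ 𝐍),
-- i.e. every point of O lies in some σ_n ⊆ O.
IsOpen : Subset → Set
IsOpen O = (∀ x → O x → 1 ≤ x)
         × (∀ x → O x → ∃ λ n → (1 ≤ n) × σ n x × (σ n ⊆ O))

N₁ : Subset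
N₁ x = 2 ≤ x

IsOpen₁ : Subset → Set₁
IsOpen₁ V = ∃ λ (O : Subset) → IsOpen O × (∀ x → V x ⇔ (N₁ x × O x))

𝐏 : Subset
𝐏 = Prime

Dense₁ : Subset → Set₁
Dense₁ A = (A ⊆ N₁) × (∀ V → IsOpen₁ V → (∃ λ x → V x) → ∃ λ x → V x × A x)

-- An open set of X₁ containing x contains a basic set σ n ∩ 𝐍₁ with gcd(n,x) = 1.
-- Any prime factor p of x (which exists as x ≥ 2) is then coprime to n as well,
-- so p lies in the same open set.
module Submission where

open import Defs
open import Data.Nat using (ℕ; zero; suc; _≤_; s≤s; z≤n; nonTrivial⇒n>1)
open import Data.Nat.Properties using (≤-trans)
open import Data.Nat.Divisibility using (_∣_; ∣-refl; ∣-trans; ∣m⇒∣m*n)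
open import Data.Nat.Coprimality using (Coprime; gcd≡1⇒coprime; coprime⇒gcd≡1)
open import Data.Nat.Primality using (Prime; prime⇒nonTrivial)
open import Data.Nat.Primality.Factorisation using (factorise)
open import Data.List using ([]; _∷_)
open import Data.Nat.ListAction using (product)
open import Data.List.Relation.Unary.All using (_∷_)
open import Data.Product using (Σ; ∃; _×_; _,_)
open import Relation.Binary.PropositionalEquality using (subst; sym)
open import Function.Bundles using (Equivalence)

prime⇒2≤ : ∀ {p} → Prime p → 2 ≤ p
prime⇒2≤ {p} pp = nonTrivial⇒n>1 p {{prime⇒nonTrivial pp}}

∃primeDivisor : ∀ n → 2 ≤ n → Σ ℕ λ p → Prime p × p ∣ n
∃primeDivisor (suc zero) (s≤s ())
∃primeDivisor (suc (suc n)) _ with factorise (suc (suc n))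
... | record { factors = [] ; isFactorisation = () }
... | record { factors = p ∷ ps ; isFactorisation = n≡∏ ; factorsPrime = pp ∷ _ } =
  p , pp , subst (p ∣_) (sym n≡∏) (∣m⇒∣m*n (product ps) ∣-refl)

coprime-∣ʳ : ∀ {m n d} → Coprime m n → d ∣ n → Coprime m d
coprime-∣ʳ m⊥n d∣n (e∣m , e∣d) = m⊥n (e∣m , ∣-trans e∣d d∣n)

prime∈σ : ∀ {n x p} → σ n x → Prime p → p ∣ x → σ n p
prime∈σ {n} {x} {p} (_ , gcd[n,x]≡1) pp p∣x =
  ≤-trans (s≤s z≤n) (prime⇒2≤ pp) ,
  coprime⇒gcd≡1 {n} {p} (coprime-∣ʳ (gcd≡1⇒coprime {n} {x} gcd[n,x]≡1) p∣x)

mainTheorem3 : Dense₁ 𝐏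
mainTheorem3 = prime⇒2≤ , meets
  where
  meets : ∀ V → IsOpen₁ V → (∃ λ x → V x) → ∃ λ x → V x × 𝐏 x
  meets V (O , (_ , nbhd) , V⇔N₁∩O) (x , Vx) with Equivalence.to (V⇔N₁∩O x) Vx
  ... | 2≤x , Ox with nbhd x Ox | ∃primeDivisor x 2≤x
  ... | n , _ , x∈σn , σn⊆O | p , pp , p∣x =
    p , Equivalence.from (V⇔N₁∩O p) (prime⇒2≤ pp , σn⊆O (prime∈σ {n} x∈σn pp p∣x)) , pp
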